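{- Let $G$ and $H$ be $\mathbb{Z}$-valued well-tempered games. If $G$ and $H$ are both even-tempered, then $R(G+H)\ge R(G)+R(H)$. If $G$ is odd-tempered and $H$ is even-tempered, then $L(G+H)\ge L(G)+R(H)$.
   Context: For $S\subseteq\mathbb{Z}$, an even-tempered $S$-valued game is either an element of $S$ (a "number", which has no options) or a pair $\langle L\mid R\rangle$ with $L,R$ finite nonempty sets of odd-tempered $S$-valued games; an odd-tempered $S$-valued game is a pair $\langle L\mid R\rangle$ with $L,R$ finite nonempty sets of even-tempered $S$-valued games (all games are built in finitely many steps). Elements of $L$ ($R$) are the left (right) options $G^L$ ($G^R$). Outcomes: for a number $n$, $L(n)=R(n)=n$; otherwise $L(G)=\max_{G^L} R(G^L)$ and $R(G)=\min_{G^R}L(G^R)$. Sum: if $G,H$ are numbers, $G+H$ is their integer sum; otherwise $G+H=\langle G^L+H,\ G+H^L\mid G^R+H,\ G+H^R\rangle$ (ranging over existing options). -}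

module Defs where

open import Data.Integer using (ℤ; _+_; _⊔_; _⊓_)

-- Finite nonempty option sets are represented by nonempty lists
-- (duplicates / order are irrelevant for outcomes and sums).
-- Temper is built into the types: an even-tempered game is a number or has
-- odd-tempered options on both sides; an odd-tempered game has even-tempered
-- options on both sides.  Nonempty option lists are defined inside the mutual
-- block so that structural recursion is visible to Agda.
mutual
  data EvenGame : Set where
    num : ℤ → EvenGame
    ⟨_∣_⟩ₑ : OddList → OddList → EvenGame

  data OddGame : Set where
    ⟨_∣_⟩ₒ : EvenList → EvenList → OddGame

  data OddList : Set where
    [_]ₒ : OddGame → OddList
    _∷ₒ_ : OddGame → OddList → OddList

  data EvenList : Set where
    [_]ₑ : EvenGame → EvenList
    _∷ₑ_ : EvenGame → EvenList → EvenList

_++ₒ_ : OddList → OddList → OddList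
[ g ]ₒ ++ₒ ys = g ∷ₒ ys
(g ∷ₒ gs) ++ₒ ys = g ∷ₒ (gs ++ₒ ys)

_++ₑ_ : EvenList → EvenList → EvenList
[ g ]ₑ ++ₑ ys = g ∷ₑ ys
(g ∷ₑ gs) ++ₑ ys = g ∷ₑ (gs ++ₑ ys)

mutual
  Lₑ : EvenGame → ℤ
  Lₑ (num n) = n
  Lₑ ⟨ l ∣ r ⟩ₑ = maxRₒ l

  Rₑ : EvenGame → ℤ
  Rₑ (num n) = n
  Rₑ ⟨ l ∣ r ⟩ₑ = minLₒ r

  Lₒ : OddGame → ℤ
  Lₒ ⟨ l ∣ r ⟩ₒ = maxRₑ l

  Rₒ : OddGame → ℤ
  Rₒ ⟨ l ∣ r ⟩ₒ = minLₑ r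

  maxRₒ : OddList → ℤ
  maxRₒ [ g ]ₒ = Rₒ g
  maxRₒ (g ∷ₒ gs) = Rₒ g ⊔ maxRₒ gs

  minLₒ : OddList → ℤ
  minLₒ [ g ]ₒ = Lₒ g
  minLₒ (g ∷ₒ gs) = Lₒ g ⊓ minLₒ gs

  maxRₑ : EvenList → ℤ
  maxRₑ [ g ]ₑ = Rₑ g
  maxRₑ (g ∷ₑ gs) = Rₑ g ⊔ maxRₑ gs

  minLₑ : EvenList → ℤ
  minLₑ [ g ]ₑ = Lₑ g
  minLₑ (g ∷ₑ gs) = Lₑ g ⊓ minLₑ gs

-- Disjunctive sums: n + m is integer addition for numbers; otherwise
-- G + H = ⟨ G^L + H, G + H^L ∣ G^R + H, G + H^R ⟩ (ranging over existing options;
-- a number contributes no options).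
mutual
  _+ee_ : EvenGame → EvenGame → EvenGame
  num m +ee num n = num (m + n)
  num m +ee ⟨ hl ∣ hr ⟩ₑ = ⟨ e+os (num m) hl ∣ e+os (num m) hr ⟩ₑ
  ⟨ gl ∣ gr ⟩ₑ +ee num n = ⟨ os+e gl (num n) ∣ os+e gr (num n) ⟩ₑ
  ⟨ gl ∣ gr ⟩ₑ +ee ⟨ hl ∣ hr ⟩ₑ =
    ⟨ os+e gl ⟨ hl ∣ hr ⟩ₑ ++ₒ e+os ⟨ gl ∣ gr ⟩ₑ hl
    ∣ os+e gr ⟨ hl ∣ hr ⟩ₑ ++ₒ e+os ⟨ gl ∣ gr ⟩ₑ hr ⟩ₑ

  _+oe_ : OddGame → EvenGame → OddGame
  ⟨ gl ∣ gr ⟩ₒ +oe num n = ⟨ es+e gl (num n) ∣ es+e gr (num n) ⟩ₒ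
  ⟨ gl ∣ gr ⟩ₒ +oe ⟨ hl ∣ hr ⟩ₑ =
    ⟨ es+e gl ⟨ hl ∣ hr ⟩ₑ ++ₑ o+os ⟨ gl ∣ gr ⟩ₒ hl
    ∣ es+e gr ⟨ hl ∣ hr ⟩ₑ ++ₑ o+os ⟨ gl ∣ gr ⟩ₒ hr ⟩ₒ

  _+eo_ : EvenGame → OddGame → OddGame
  num m +eo ⟨ hl ∣ hr ⟩ₒ = ⟨ e+es (num m) hl ∣ e+es (num m) hr ⟩ₒ
  ⟨ gl ∣ gr ⟩ₑ +eo ⟨ hl ∣ hr ⟩ₒ =
    ⟨ os+o gl ⟨ hl ∣ hr ⟩ₒ ++ₑ e+es ⟨ gl ∣ gr ⟩ₑ hl
    ∣ os+o gr ⟨ hl ∣ hr ⟩ₒ ++ₑ e+es ⟨ gl ∣ gr ⟩ₑ hr ⟩ₒ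

  _+oo_ : OddGame → OddGame → EvenGame
  ⟨ gl ∣ gr ⟩ₒ +oo ⟨ hl ∣ hr ⟩ₒ =
    ⟨ es+o gl ⟨ hl ∣ hr ⟩ₒ ++ₒ o+es ⟨ gl ∣ gr ⟩ₒ hl
    ∣ es+o gr ⟨ hl ∣ hr ⟩ₒ ++ₒ o+es ⟨ gl ∣ gr ⟩ₒ hr ⟩ₑ

  os+e : OddList → EvenGame → OddList
  os+e [ g ]ₒ h = [ g +oe h ]ₒ
  os+e (g ∷ₒ gs) h = (g +oe h) ∷ₒ os+e gs h

  es+e : EvenList → EvenGame → EvenList
  es+e [ g ]ₑ h = [ g +ee h ]ₑ
  es+e (g ∷ₑ gs) h = (g +ee h) ∷ₑ es+e gs h

  os+o : OddList → OddGame → EvenList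
  os+o [ g ]ₒ h = [ g +oo h ]ₑ
  os+o (g ∷ₒ gs) h = (g +oo h) ∷ₑ os+o gs h

  es+o : EvenList → OddGame → OddList
  es+o [ g ]ₑ h = [ g +eo h ]ₒ
  es+o (g ∷ₑ gs) h = (g +eo h) ∷ₒ es+o gs h

  e+os : EvenGame → OddList → OddList
  e+os g [ h ]ₒ = [ g +eo h ]ₒ
  e+os g (h ∷ₒ hs) = (g +eo h) ∷ₒ e+os g hs

  e+es : EvenGame → EvenList → EvenList
  e+es g [ h ]ₑ = [ g +ee h ]ₑ
  e+es g (h ∷ₑ hs) = (g +ee h) ∷ₑ e+es g hs

  o+os : OddGame → OddList → EvenList
  o+os g [ h ]ₒ = [ g +oo h ]ₑ
  o+os g (h ∷ₒ hs) = (g +oo h) ∷ₑ o+os g hs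

  o+es : OddGame → EvenList → OddList
  o+es g [ h ]ₑ = [ g +oe h ]ₒ
  o+es g (h ∷ₑ hs) = (g +oe h) ∷ₒ o+es g hs

module Submission where

-- The two claimed inequalities are proved simultaneously with two mirror
-- images, by mutual structural induction on the games:
--   (even+even)  R(G + H) ≥ R(G) + R(H),
--   (odd+even)   L(G + H) ≥ L(G) + R(H),   (even+odd)  L(G + H) ≥ R(G) + L(H).
-- Right, moving first in G + H, must move in one component, reaching either
-- G^R + H or G + H^R; by the odd/even cases each such position has left
-- outcome at least R(G) + R(H), so the minimum does too.  Left, moving first
-- in an odd-tempered G + H, may simply answer in the odd component: choosing
-- the best G^L gives at least max R(G^L) + R(H) = L(G) + R(H) by the
-- even+even case.  The options of a sum are lists built by mapping over the
-- option lists of the summands, so the induction is phrased pointwise on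
-- those lists.

open import Defs
open import Data.Integer using (ℤ; _+_; _≥_; _≤_; _⊔_; _⊓_)
open import Data.Integer.Properties
  using (≤-refl; ≤-trans; ⊓-glb; i⊓j≤i; i⊓j≤j; i≤i⊔j; i≤j⊔i; ⊔-mono-≤; ⊓-assoc; ⊔-assoc;
         mono-≤-distrib-⊔; +-monoˡ-≤; +-monoʳ-≤)
open import Data.Product using (_×_; _,_)
open import Relation.Binary.PropositionalEquality using (_≡_; refl; cong; trans; subst; sym)
open import Relation.Binary.Definitions using (Monotonic₁)

⊓-lowerBound : ∀ {f : ℤ → ℤ} → Monotonic₁ _≤_ _≤_ f →
               ∀ {a b x y} → a ≥ f x → b ≥ f y → a ⊓ b ≥ f (x ⊓ y)
⊓-lowerBound f-mono a≥fx b≥fy =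
  ⊓-glb (≤-trans (f-mono (i⊓j≤i _ _)) a≥fx) (≤-trans (f-mono (i⊓j≤j _ _)) b≥fy)

⊔-lowerBound : ∀ {f : ℤ → ℤ} → Monotonic₁ _≤_ _≤_ f →
               ∀ {a b x y} → a ≥ f x → b ≥ f y → a ⊔ b ≥ f (x ⊔ y)
⊔-lowerBound {f} f-mono {a} {b} {x} {y} a≥fx b≥fy =
  subst (_≤ a ⊔ b) (sym (mono-≤-distrib-⊔ f-mono x y)) (⊔-mono-≤ a≥fx b≥fy)

minLₒ-++ : (xs ys : OddList) → minLₒ (xs ++ₒ ys) ≡ minLₒ xs ⊓ minLₒ ys
minLₒ-++ [ x ]ₒ ys = refl
minLₒ-++ (x ∷ₒ xs) ys =
  trans (cong (Lₒ x ⊓_) (minLₒ-++ xs ys)) (sym (⊓-assoc (Lₒ x) (minLₒ xs) (minLₒ ys)))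

maxRₑ-++ : (xs ys : EvenList) → maxRₑ (xs ++ₑ ys) ≡ maxRₑ xs ⊔ maxRₑ ys
maxRₑ-++ [ x ]ₑ ys = refl
maxRₑ-++ (x ∷ₑ xs) ys =
  trans (cong (Rₑ x ⊔_) (maxRₑ-++ xs ys)) (sym (⊔-assoc (Rₑ x) (maxRₑ xs) (maxRₑ ys)))

minLₒ-++-glb : ∀ {c} (xs ys : OddList) → minLₒ xs ≥ c → minLₒ ys ≥ c →
               minLₒ (xs ++ₒ ys) ≥ c
minLₒ-++-glb xs ys xs≥c ys≥c =
  subst (_ ≤_) (sym (minLₒ-++ xs ys)) (⊓-glb xs≥c ys≥c)

maxRₑ-++-≥ˡ : (xs ys : EvenList) → maxRₑ (xs ++ₑ ys) ≥ maxRₑ xs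
maxRₑ-++-≥ˡ xs ys = subst (_ ≤_) (sym (maxRₑ-++ xs ys)) (i≤i⊔j _ _)

maxRₑ-++-≥ʳ : (xs ys : EvenList) → maxRₑ (xs ++ₑ ys) ≥ maxRₑ ys
maxRₑ-++-≥ʳ xs ys = subst (_ ≤_) (sym (maxRₑ-++ xs ys)) (i≤j⊔i _ _)

mutual
  R-superadditive : (G H : EvenGame) → Rₑ (G +ee H) ≥ Rₑ G + Rₑ H
  R-superadditive (num m) (num n) = ≤-refl
  R-superadditive (num m) ⟨ hl ∣ hr ⟩ₑ = minL-e+os (num m) hr
  R-superadditive ⟨ gl ∣ gr ⟩ₑ (num n) = minL-os+e gr (num n)
  R-superadditive G@(⟨ gl ∣ gr ⟩ₑ) H@(⟨ hl ∣ hr ⟩ₑ) =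
    minLₒ-++-glb (os+e gr H) (e+os G hr) (minL-os+e gr H) (minL-e+os G hr)

  -- Left moving first in odd + even answers in the odd component.
  L-oddEven : (G : OddGame) (H : EvenGame) → Lₒ (G +oe H) ≥ Lₒ G + Rₑ H
  L-oddEven ⟨ gl ∣ gr ⟩ₒ (num n) = maxR-es+e gl (num n)
  L-oddEven G@(⟨ gl ∣ gr ⟩ₒ) H@(⟨ hl ∣ hr ⟩ₑ) =
    ≤-trans (maxR-es+e gl H) (maxRₑ-++-≥ˡ (es+e gl H) (o+os G hl))

  L-evenOdd : (G : EvenGame) (H : OddGame) → Lₒ (G +eo H) ≥ Rₑ G + Lₒ H
  L-evenOdd (num m) ⟨ hl ∣ hr ⟩ₒ = maxR-e+es (num m) hl
  L-evenOdd G@(⟨ gl ∣ gr ⟩ₑ) H@(⟨ hl ∣ hr ⟩ₒ) =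
    ≤-trans (maxR-e+es G hl) (maxRₑ-++-≥ʳ (os+o gl H) (e+es G hl))

  minL-os+e : (gr : OddList) (H : EvenGame) → minLₒ (os+e gr H) ≥ minLₒ gr + Rₑ H
  minL-os+e [ g ]ₒ H = L-oddEven g H
  minL-os+e (g ∷ₒ gs) H = ⊓-lowerBound (+-monoˡ-≤ (Rₑ H)) {x = Lₒ g} (L-oddEven g H) (minL-os+e gs H)

  minL-e+os : (G : EvenGame) (hr : OddList) → minLₒ (e+os G hr) ≥ Rₑ G + minLₒ hr
  minL-e+os G [ h ]ₒ = L-evenOdd G h
  minL-e+os G (h ∷ₒ hs) = ⊓-lowerBound (+-monoʳ-≤ (Rₑ G)) {x = Lₒ h} (L-evenOdd G h) (minL-e+os G hs)

  maxR-es+e : (gl : EvenList) (H : EvenGame) → maxRₑ (es+e gl H) ≥ maxRₑ gl + Rₑ H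
  maxR-es+e [ g ]ₑ H = R-superadditive g H
  maxR-es+e (g ∷ₑ gs) H =
    ⊔-lowerBound (+-monoˡ-≤ (Rₑ H)) {x = Rₑ g} (R-superadditive g H) (maxR-es+e gs H)

  maxR-e+es : (G : EvenGame) (hl : EvenList) → maxRₑ (e+es G hl) ≥ Rₑ G + maxRₑ hl
  maxR-e+es G [ h ]ₑ = R-superadditive G h
  maxR-e+es G (h ∷ₑ hs) =
    ⊔-lowerBound (+-monoʳ-≤ (Rₑ G)) {x = Rₑ h} (R-superadditive G h) (maxR-e+es G hs)

mainTheorem2 : ((G H : EvenGame) → Rₑ (G +ee H) ≥ Rₑ G + Rₑ H)
    × ((G : OddGame) (H : EvenGame) → Lₒ (G +oe H) ≥ Lₒ G + Rₑ H)
mainTheorem2 = R-superadditive , L-oddEven
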